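{- Let $a$ be an integer with $a>2$. The Pell equation $x^{2}-\left(a^{2}+2a\right)y^{2}=-4$ has no positive integer solutions. -}

{-# OPTIONS --safe #-}
module Submission where

-- Infinite descent. With D = a² + 2a = (a + 1)² − 1, the map
-- (x , y) ↦ ((a + 1) x − D y , (a + 1) y − x) is multiplication by the unit
-- (a + 1) − √D of norm 1, so it preserves x² − D y². On a solution of
-- x² − D y² = −4 with x ≥ 0 and y > 0 the new y is still positive, and it is
-- smaller than y because x > a y, which is where a > 2 is needed (for a = 2,
-- (x , y) = (2 , 1) is a solution).

open import Data.Integer using (ℤ; +_; -_; _+_; _-_; _*_; _<_)
open import Relation.Binary.PropositionalEquality using (_≡_)
open import Relation.Nullary using (¬_)

open import Data.Integer.Base using (-[1+_]; ∣_∣; _≤_; +≤+; +<+; nonNegative)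
open import Data.Integer.Properties
  using ( ≤-trans; <-≤-trans; <⇒≤; ≤-reflexive; +-mono-≤; +-mono-≤-<; +-mono-<; +-monoʳ-<
        ; +-monoˡ-<; +-identityʳ; +-inverseʳ; *-identityʳ; *-monoˡ-≤-nonNeg; *-monoʳ-≤-nonNeg
        ; *-cancelʳ-<-nonNeg; i<j⇒suc[i]≤j; 0≤i⇒+∣i∣≡i; drop‿+<+; module ≤-Reasoning )
open import Data.Integer.Tactic.RingSolver using (solve-∀)
open import Data.Nat as ℕ using (s≤s; z≤n)
open import Data.Nat.Induction using (<-wellFounded)
open import Function using (_on_)
open import Induction.WellFounded using (Acc; acc)
open import Relation.Binary.Construct.On using (wellFounded)
open import Relation.Binary.PropositionalEquality
  using (refl; sym; trans; subst; subst₂; cong; module ≡-Reasoning)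

0≤i*j : ∀ {i j} → + 0 ≤ i → + 0 ≤ j → + 0 ≤ i * j
0≤i*j {i} {j} 0≤i 0≤j = *-monoʳ-≤-nonNeg j ⦃ nonNegative 0≤j ⦄ 0≤i

i≤i*j : ∀ {i j} → + 0 ≤ i → + 0 < j → i ≤ i * j
i≤i*j {i} {j} 0≤i 0<j = ≤-trans (≤-reflexive (sym (*-identityʳ i)))
  (*-monoˡ-≤-nonNeg i ⦃ nonNegative 0≤i ⦄ (i<j⇒suc[i]≤j 0<j))

0<i*i : ∀ {i} → + 0 < i → + 0 < i * i
0<i*i 0<i = <-≤-trans 0<i (i≤i*j (<⇒≤ 0<i) 0<i)

0<i*j⇒0<i : ∀ {i j} → + 0 ≤ j → + 0 < i * j → + 0 < i
0<i*j⇒0<i {j = j} 0≤j = *-cancelʳ-<-nonNeg j ⦃ nonNegative 0≤j ⦄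

i<j⇒0<j-i : ∀ {i j} → i < j → + 0 < j - i
i<j⇒0<j-i {i} {j} i<j = subst (_< j - i) (+-inverseʳ i) (+-monoˡ-< (- i) i<j)

0≤i<j⇒∣i∣<∣j∣ : ∀ {i j} → + 0 ≤ i → i < j → ∣ i ∣ ℕ.< ∣ j ∣
0≤i<j⇒∣i∣<∣j∣ {j = j} 0≤i i<j = drop‿+<+ (subst₂ _<_ (sym (0≤i⇒+∣i∣≡i 0≤i)) (sym (0≤i⇒+∣i∣≡i 0≤j)) i<j)
  where
  0≤j : + 0 ≤ j
  0≤j = ≤-trans 0≤i (<⇒≤ i<j)

norm : ℤ → ℤ → ℤ → ℤ
norm a x y = x * x - (a * a + + 2 * a) * (y * y)

norm-∣x∣ : ∀ a x y → norm a (+ ∣ x ∣) y ≡ norm a x y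
norm-∣x∣ a (+ n)      y = refl
norm-∣x∣ a -[1+ n ]   y = refl

descend-x : ℤ → ℤ → ℤ → ℤ
descend-x a x y = (a + + 1) * x - (a * a + + 2 * a) * y

descend-y : ℤ → ℤ → ℤ → ℤ
descend-y a x y = (a + + 1) * y - x

norm-descend : ∀ a x y → norm a (descend-x a x y) (descend-y a x y) ≡ norm a x y
norm-descend = identity
  where
  identity : ∀ a x y →
    ((a + + 1) * x - (a * a + + 2 * a) * y) * ((a + + 1) * x - (a * a + + 2 * a) * y)
      - (a * a + + 2 * a) * (((a + + 1) * y - x) * ((a + + 1) * y - x))
    ≡ x * x - (a * a + + 2 * a) * (y * y)
  identity = solve-∀

module _ {a x y : ℤ} (2<a : + 2 < a) (0≤x : + 0 ≤ x) (0<y : + 0 < y)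
         (sol : norm a x y ≡ - + 4) where

  private
    0≤a : + 0 ≤ a
    0≤a = ≤-trans (+≤+ z≤n) (<⇒≤ 2<a)

    0≤y : + 0 ≤ y
    0≤y = <⇒≤ 0<y

    P : ℤ
    P = a * (y * y)

    2<P : + 2 < P
    2<P = <-≤-trans 2<a (i≤i*j 0≤a (0<i*i 0<y))

  0<descend-y : + 0 < descend-y a x y
  0<descend-y = 0<i*j⇒0<i 0≤sum (subst (+ 0 <_) (sym conjugate-product) 0<y²+4)
    where
    open ≡-Reasoning
    identity : ∀ a x y →
      ((a + + 1) * y - x) * ((a + + 1) * y + x) ≡ y * y - (x * x - (a * a + + 2 * a) * (y * y))
    identity = solve-∀
    0≤sum : + 0 ≤ (a + + 1) * y + x
    0≤sum = +-mono-≤ (0≤i*j (+-mono-≤ 0≤a (+≤+ z≤n)) 0≤y) 0≤x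
    0<y²+4 : + 0 < y * y + + 4
    0<y²+4 = +-mono-≤-< (0≤i*j 0≤y 0≤y) (+<+ (s≤s z≤n))
    conjugate-product : descend-y a x y * ((a + + 1) * y + x) ≡ y * y + + 4
    conjugate-product = begin
      descend-y a x y * ((a + + 1) * y + x) ≡⟨ identity a x y ⟩
      y * y - norm a x y                    ≡⟨ cong (λ n → y * y - n) sol ⟩
      y * y + + 4                           ∎

  0<x-ay : + 0 < x - a * y
  0<x-ay = 0<i*j⇒0<i 0≤x+ay (subst (+ 0 <_) (sym conjugate-product) 0<[P-2]+[P-2])
    where
    open ≡-Reasoning
    identity : ∀ a x y → (x - a * y) * (x + a * y)
                         ≡ (x * x - (a * a + + 2 * a) * (y * y)) + (a * (y * y) + a * (y * y))
    identity = solve-∀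
    regroup : ∀ i → - + 4 + (i + i) ≡ (i - + 2) + (i - + 2)
    regroup = solve-∀
    0≤x+ay : + 0 ≤ x + a * y
    0≤x+ay = +-mono-≤ 0≤x (0≤i*j 0≤a 0≤y)
    0<[P-2]+[P-2] : + 0 < (P - + 2) + (P - + 2)
    0<[P-2]+[P-2] = +-mono-< (i<j⇒0<j-i 2<P) (i<j⇒0<j-i 2<P)
    conjugate-product : (x - a * y) * (x + a * y) ≡ (P - + 2) + (P - + 2)
    conjugate-product = begin
      (x - a * y) * (x + a * y) ≡⟨ identity a x y ⟩
      norm a x y + (P + P)      ≡⟨ cong (_+ (P + P)) sol ⟩
      - + 4 + (P + P)           ≡⟨ regroup P ⟩
      (P - + 2) + (P - + 2)     ∎

  descend-y<y : descend-y a x y < y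
  descend-y<y = begin-strict
    descend-y a x y                ≡⟨ +-identityʳ _ ⟨
    descend-y a x y + + 0          <⟨ +-monoʳ-< (descend-y a x y) 0<x-ay ⟩
    descend-y a x y + (x - a * y)  ≡⟨ identity a x y ⟨
    y                              ∎
    where
    open ≤-Reasoning
    identity : ∀ a x y → y ≡ ((a + + 1) * y - x) + (x - a * y)
    identity = solve-∀

no-solution : ∀ {a} → + 2 < a → ∀ {y} → Acc (ℕ._<_ on ∣_∣) y →
              ∀ x → + 0 ≤ x → + 0 < y → ¬ (norm a x y ≡ - + 4)
no-solution {a} 2<a {y} (acc smaller) x 0≤x 0<y sol =
  no-solution 2<a (smaller ∣y′∣<∣y∣) (+ ∣ descend-x a x y ∣) (+≤+ z≤n) 0<y′ sol′
  where
  0<y′ : + 0 < descend-y a x y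
  0<y′ = 0<descend-y 2<a 0≤x 0<y sol
  ∣y′∣<∣y∣ : ∣ descend-y a x y ∣ ℕ.< ∣ y ∣
  ∣y′∣<∣y∣ = 0≤i<j⇒∣i∣<∣j∣ (<⇒≤ 0<y′) (descend-y<y 2<a 0≤x 0<y sol)
  sol′ : norm a (+ ∣ descend-x a x y ∣) (descend-y a x y) ≡ - + 4
  sol′ = trans (norm-∣x∣ a (descend-x a x y) (descend-y a x y))
                (trans (norm-descend a x y) sol)

theorem11 : (a : ℤ) → + 2 < a → (x y : ℤ) → + 0 < x → + 0 < y →
    ¬ (x * x - (a * a + + 2 * a) * (y * y) ≡ - + 4)
theorem11 a 2<a x y 0<x 0<y =
  no-solution 2<a (wellFounded ∣_∣ <-wellFounded y) x (<⇒≤ 0<x) 0<y
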